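{- For every $n\ge1$, $\dim\mathbf{\Pi}^{(m)}_n=f_{m,n}$, where $f_{m,n}$ is given by $f_{m,1}=m$, $f_{m,2}=m^2$, and $f_{m,n}=mf_{m,n-1}+f_{m,n-2}$ for $n\ge3$.
   Context: Let $\omega$ be a primitive $m$th root of unity. An $m$-colored composition of $n$ is $\alpha=(\omega^{j_1}\alpha_1,\ldots,\omega^{j_k}\alpha_k)$ with positive integers $\alpha_i$ summing to $n$ and colors $j_i\in\{0,\ldots,m-1\}$; $l(\alpha)=k$. $M^{(m)}_\alpha=\sum x_{i_1,j_1}^{\alpha_1}\cdots x_{i_k,j_k}^{\alpha_k}$ over $i_1,\ldots,i_k$ with $(i_1,j_1)<\cdots<(i_k,j_k)$ lexicographically. The rainbow decomposition $\alpha=\alpha_{(1)}\cdots\alpha_{(r)}$ splits $\alpha$ into maximal blocks of consecutive parts of equal color, block $\alpha_{(i)}$ having color $\epsilon_i$. For uncolored compositions, refinement order is generated by $(\ldots,a+b,\ldots)<(\ldots,a,b,\ldots)$, and for $\beta=(\beta_1,\ldots,\beta_l)$, $\beta^*$ replaces each part $\beta_i\ge2$ with $i>1$ by the two parts $(1,\beta_i-1)$. Define $K^{(m)}_\alpha=\sum 2^{\sum_i l(\beta_{(i)})}M^{(m)}_{\epsilon_1\beta_{(1)}\cdots\epsilon_r\beta_{(r)}}$, the sum over all tuples of uncolored compositions $\beta_{(1)},\ldots,\beta_{(r)}$ with $|\beta_{(i)}|=|\alpha_{(i)}|$ and $\alpha_{(i)}\le\beta_{(i)}^*$ (colors of $\alpha_{(i)}$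 forgotten), where $\epsilon_i\beta_{(i)}$ gives every part of $\beta_{(i)}$ color $\epsilon_i$ and the result is concatenated. A peak composition is a composition whose parts except possibly the last exceed $1$; an $m$-colored peak composition is one each of whose rainbow blocks is a peak composition. $\mathbf{\Pi}^{(m)}_n$ is the $\mathbb{Q}$-span of the $K^{(m)}_\alpha$ over all $m$-colored peak compositions $\alpha$ of $n$. -}

module Defs where

open import Data.Nat as ℕ using (ℕ; zero; suc; _+_; _*_; _∸_; _^_; _≤ᵇ_; _≡ᵇ_; _<ᵇ_)
open import Data.Bool using (Bool; true; false; _∧_; if_then_else_)
open import Data.Fin as Fin using (Fin)
open import Data.List using (List; []; _∷_; [_]; map; concatMap; foldr; _++_; length; allFin; lookup)
open import Data.List.Properties as LP using ()
open import Data.Product using (_×_; _,_; proj₁; proj₂; ∃; Σ)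
open import Data.Product.Properties as PP using ()
open import Data.Integer using (+_)
open import Data.Rational as ℚ using (ℚ; 0ℚ)
open import Relation.Nullary using (does)
open import Relation.Binary.PropositionalEquality using (_≡_)

compsS : ℕ → List (List ℕ)          -- compositions of (suc n)
compsS zero    = [ [ 1 ] ]
compsS (suc n) = map incHead (compsS n) ++ map (1 ∷_) (compsS n)
  where
  incHead : List ℕ → List ℕ
  incHead []       = []
  incHead (a ∷ as) = suc a ∷ as

comps : ℕ → List (List ℕ)
comps zero    = [ [] ]
comps (suc n) = compsS n

sumℕ : List ℕ → ℕ
sumℕ = foldr _+_ 0

-- Refinement order:  α ≤ γ  iff α is obtained from γ by merging
-- consecutive blocks of parts (the order generated by
-- (…,a+b,…) < (…,a,b,…)).  Decided greedily (parts are positive).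
leq : List ℕ → List ℕ → Bool
leq []       []       = true
leq []       (g ∷ gs) = false
leq (a ∷ as) []       = false
leq (a ∷ as) (g ∷ gs) =
  if a ≡ᵇ g then leq as gs
  else if g <ᵇ a then leq ((a ∸ g) ∷ as) gs
  else false

starRest : List ℕ → List ℕ
starRest []       = []
starRest (b ∷ bs) = if 2 ≤ᵇ b then 1 ∷ (b ∸ 1) ∷ starRest bs else b ∷ starRest bs

star : List ℕ → List ℕ
star []       = []
star (b ∷ bs) = b ∷ starRest bs

isPeak : List ℕ → Bool
isPeak []           = true
isPeak (a ∷ [])     = true
isPeak (a ∷ b ∷ bs) = (2 ≤ᵇ a) ∧ isPeak (b ∷ bs)

allTrue : List Bool → Bool
allTrue = foldr _∧_ true

-- m-colored compositions: list of (part, color); part (a , j) is ω^j a.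

CComp : ℕ → Set
CComp m = List (ℕ × Fin m)

colorings : (m : ℕ) → List ℕ → List (CComp m)
colorings m []       = [ [] ]
colorings m (a ∷ as) =
  concatMap (λ j → map ((a , j) ∷_) (colorings m as)) (allFin m)

ccomps : (m n : ℕ) → List (CComp m)
ccomps m n = concatMap (colorings m) (comps n)

rainbow : {m : ℕ} → CComp m → List (Fin m × List ℕ)
rainbow []            = []
rainbow ((a , j) ∷ α) = glue (rainbow α)
  where
  glue : List (Fin _ × List ℕ) → List (Fin _ × List ℕ)
  glue []               = (j , [ a ]) ∷ []
  glue ((j' , bs) ∷ bl) =
    if does (j Fin.≟ j') then (j , a ∷ bs) ∷ bl
    else (j , [ a ]) ∷ (j' , bs) ∷ bl

isCPeak : {m : ℕ} → CComp m → Bool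
isCPeak α = allTrue (map (λ b → isPeak (proj₂ b)) (rainbow α))

peakComps : (m n : ℕ) → List (CComp m)
peakComps m n = Data.List.filterᵇ isCPeak (ccomps m n)
  where import Data.List

-- Colored quasisymmetric functions, in the basis M^(m)_β of monomial
-- quasisymmetric functions: a formal sum Σ w · M_β is a list of (w , β).

Formal : ℕ → Set
Formal m = List (ℕ × CComp m)

blockTerms : {m : ℕ} → Fin m → List ℕ → Formal m
blockTerms ε a =
  concatMap (λ β → if leq a (star β)
                     then [ (2 ^ length β , map (λ b → (b , ε)) β) ]
                     else [])
            (comps (sumℕ a))

prodTerms : {m : ℕ} → Formal m → Formal m → Formal m
prodTerms xs ys =
  concatMap (λ x → map (λ y → (proj₁ x * proj₁ y , proj₂ x ++ proj₂ y)) ys) xs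

Kterms : {m : ℕ} → CComp m → Formal m
Kterms α = foldr (λ b acc → prodTerms (blockTerms (proj₁ b) (proj₂ b)) acc)
                 ((1 , []) ∷ []) (rainbow α)

_≟C_ : {m : ℕ} → (α β : CComp m) → Bool
α ≟C β = does (LP.≡-dec (PP.≡-dec ℕ._≟_ Fin._≟_) α β)

coeffℕ : {m : ℕ} → Formal m → CComp m → ℕ
coeffℕ []             β = 0
coeffℕ ((w , γ) ∷ xs) β = (if γ ≟C β then w else 0) + coeffℕ xs β

-- an element of QSym^(m) (over ℚ) as its coefficient function in the M-basis
QVec : ℕ → Set
QVec m = CComp m → ℚ

K : {m : ℕ} → CComp m → QVec m
K α β = (+ coeffℕ (Kterms α) β) ℚ./ 1

sumFin : (k : ℕ) → (Fin k → ℚ) → ℚ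
sumFin zero    f = 0ℚ
sumFin (suc k) f = f Fin.zero ℚ.+ sumFin k (λ i → f (Fin.suc i))

combo : {m k : ℕ} → (Fin k → ℚ) → (Fin k → QVec m) → QVec m
combo {k = k} c v β = sumFin k (λ i → c i ℚ.* v i β)

LinIndep : {m k : ℕ} → (Fin k → QVec m) → Set
LinIndep {k = k} v = ∀ (c : Fin k → ℚ) → (∀ β → combo c v β ≡ 0ℚ) → ∀ i → c i ≡ 0ℚ

InSpan : {m k : ℕ} → (Fin k → QVec m) → QVec m → Set
InSpan {k = k} v w = ∃ λ (c : Fin k → ℚ) → ∀ β → combo c v β ≡ w β

SpanDim : {m k : ℕ} → (Fin k → QVec m) → ℕ → Set
SpanDim {m} {k} v d =
  Σ (Fin d → QVec m) λ b →
    LinIndep b × (∀ j → InSpan v (b j)) × (∀ i → InSpan b (v i))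

-- the spanning family of Π^(m)_n : K^(m)_α for α an m-colored peak composition of n
PiFamily : (m n : ℕ) → Fin (length (peakComps m n)) → QVec m
PiFamily m n i = K (lookup (peakComps m n) i)

f : ℕ → ℕ → ℕ
f m zero                  = 1
f m (suc zero)            = m
f m (suc (suc zero))      = m * m
f m (suc (suc (suc n)))   = m * f m (suc (suc n)) + f m (suc n)

-- Blockwise along the rainbow decomposition, a peak composition a with a ≤ β* forces β ≤ a
-- lexicographically, so in the monomial basis K_α is M_α, with the positive coefficient
-- ∏ᵢ 2^{l(α_(i))}, plus terms M_γ with parts γ lexicographically smaller than those of α. Hence
-- the K_α are linearly independent and dim Π^(m)_n is the number of m-colored peak compositions
-- of n. With the colour of the first part fixed, a composition (b₁, …, b_k) has ∏_{i<k} c(bᵢ)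
-- peak colourings, where c(b) = m for b ≥ 2 and c(1) = m - 1 (the colour must change after a
-- non-final part 1); splitting the compositions of n + 1 by whether the first part is 1 turns
-- this into f_{m,n} = m f_{m,n-1} + f_{m,n-2}.
module Submission where

open import Defs
open import Data.Nat as ℕ using (ℕ; zero; suc; _+_; _*_; _^_; _<_; _≤_; _≤ᵇ_; _≡ᵇ_; _<ᵇ_)
import Data.Nat.Properties as ℕP
open import Data.Nat.ListAction using (sum)
open import Data.Nat.ListAction.Properties using (sum-++)
open import Data.Nat.Tactic.RingSolver using (solve-∀)
open import Data.Fin as Fin using (Fin; zero; suc; punchIn; punchOut)
open import Data.Fin.Properties using (punchInᵢ≢i; punchIn-injective; punchIn-punchOut)
import Data.Integer as ℤ
open import Data.Rational as ℚ using (ℚ; 0ℚ; 1ℚ)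
import Data.Rational.Properties as ℚP
open import Data.Bool using (Bool; true; false; T; _∧_; if_then_else_)
open import Data.Bool.Properties using (∧-assoc)
open import Data.List as List
  using (List; []; _∷_; [_]; _++_; map; concatMap; length; lookup; allFin; tabulate; filterᵇ)
open import Data.List.Properties as ListP
  using (map-++; map-∘; map-cong; map-cong-local; map-tabulate; length-++; filter-++; ∷-injectiveʳ)
open import Data.List.Membership.Propositional using (_∈_; find; lose)
open import Data.List.Membership.Propositional.Properties
  using (∈-map⁺; ∈-map⁻; ∈-++⁺ˡ; ∈-++⁺ʳ; ∈-concatMap⁺; ∈-concatMap⁻; ∈-filter⁻; ∈-lookup)
open import Data.List.Relation.Unary.All as All using (All; []; _∷_)
import Data.List.Relation.Unary.All.Properties as All
open import Data.List.Relation.Unary.Any using (here; there)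
open import Data.List.Relation.Unary.AllPairs as AllPairs using ([]; _∷_)
import Data.List.Relation.Unary.AllPairs.Properties as AllPairs
open import Data.List.Relation.Unary.Unique.Propositional using (Unique)
import Data.List.Relation.Unary.Unique.Propositional.Properties as Unique
open import Data.List.Relation.Binary.Disjoint.Propositional using (Disjoint)
open import Data.Product using (∃; ∃₂; _×_; _,_; proj₁; proj₂; map₂)
import Data.Product.Properties as ×P
open import Data.Sum using (_⊎_; inj₁; inj₂)
open import Data.Empty using (⊥-elim)
open import Function using (_∘_; id)
open import Level using (0ℓ)
open import Relation.Binary.Core using (Rel)
open import Relation.Binary.Definitions using (Transitive; Decidable; DecidableEquality)
open import Relation.Binary.PropositionalEquality
  using (_≡_; _≢_; refl; sym; trans; cong; cong₂; subst; module ≡-Reasoning)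
open import Relation.Nullary using (¬_; yes; no; does)
open import Relation.Nullary.Decidable using (dec-true; dec-false; toWitness; isYes≗does; T?)
open import Algebra.Properties.CommutativeMonoid.Sum ℚP.+-0-commutativeMonoid as ℚΣ using ()
open import Algebra.Properties.CommutativeMonoid.Sum ℕP.+-0-commutativeMonoid as ℕΣ using ()

sumFin≡sum : ∀ k (g : Fin k → ℚ) → sumFin k g ≡ ℚΣ.sum g
sumFin≡sum zero    g = refl
sumFin≡sum (suc k) g = cong (g zero ℚ.+_) (sumFin≡sum k (g ∘ suc))

p*q≡0⇒p≡0 : ∀ p q → q ≢ 0ℚ → p ℚ.* q ≡ 0ℚ → p ≡ 0ℚ
p*q≡0⇒p≡0 p q q≢0 pq≡0 = begin
  p                      ≡⟨ sym (ℚP.*-identityʳ p) ⟩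
  p ℚ.* 1ℚ               ≡⟨ cong (p ℚ.*_) (sym (ℚP.*-inverseʳ q)) ⟩
  p ℚ.* (q ℚ.* ℚ.1/ q)   ≡⟨ sym (ℚP.*-assoc p q (ℚ.1/ q)) ⟩
  (p ℚ.* q) ℚ.* ℚ.1/ q   ≡⟨ cong (ℚ._* ℚ.1/ q) pq≡0 ⟩
  0ℚ ℚ.* ℚ.1/ q          ≡⟨ ℚP.*-zeroˡ (ℚ.1/ q) ⟩
  0ℚ                     ∎
  where
  open ≡-Reasoning
  instance
    q-nonZero : ℚ.NonZero q
    q-nonZero = ℚ.≢-nonZero q≢0

+n/1≢0 : ∀ {n} → 0 < n → (ℤ.+ n) ℚ./ 1 ≢ 0ℚ
+n/1≢0 {suc n} _ n/1≡0 with subst ℚ.Positive n/1≡0 (ℚP.normalize-pos (suc n) 1)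
... | ()

module _ {m : ℕ} where

  combo-remove : ∀ {k} (c : Fin (suc k) → ℚ) (v : Fin (suc k) → QVec m) i β →
                 combo c v β ≡ c i ℚ.* v i β ℚ.+ combo (c ∘ punchIn i) (v ∘ punchIn i) β
  combo-remove {k} c v i β = begin
    combo c v β
      ≡⟨ sumFin≡sum (suc k) term ⟩
    ℚΣ.sum term
      ≡⟨ ℚΣ.sum-remove {i = i} term ⟩
    c i ℚ.* v i β ℚ.+ ℚΣ.sum (λ j → c (punchIn i j) ℚ.* v (punchIn i j) β)
      ≡⟨ cong (c i ℚ.* v i β ℚ.+_) (sym (sumFin≡sum k (term ∘ punchIn i))) ⟩
    c i ℚ.* v i β ℚ.+ combo (c ∘ punchIn i) (v ∘ punchIn i) β
      ∎
    where
    open ≡-Reasoning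
    term : Fin (suc k) → ℚ
    term j = c j ℚ.* v j β

  combo≡0 : ∀ {k} (c : Fin k → ℚ) (v : Fin k → QVec m) β →
            (∀ i → c i ≡ 0ℚ ⊎ v i β ≡ 0ℚ) → combo c v β ≡ 0ℚ
  combo≡0 {k} c v β vanish = begin
    combo c v β                       ≡⟨ sumFin≡sum k (λ i → c i ℚ.* v i β) ⟩
    ℚΣ.sum (λ i → c i ℚ.* v i β)      ≡⟨ ℚΣ.sum-cong-≗ term≡0 ⟩
    ℚΣ.sum {k} (λ _ → 0ℚ)             ≡⟨ ℚΣ.sum-replicate-zero k ⟩
    0ℚ                                ∎
    where
    open ≡-Reasoning
    term≡0 : ∀ i → c i ℚ.* v i β ≡ 0ℚ
    term≡0 i with vanish i
    ... | inj₁ c≡0 = trans (cong (ℚ._* v i β) c≡0) (ℚP.*-zeroˡ (v i β))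
    ... | inj₂ v≡0 = trans (cong (c i ℚ.*_) v≡0) (ℚP.*-zeroʳ (c i))

module _ {A : Set} {_≺_ : Rel A 0ℓ} (≺-irrefl : ∀ {x} → ¬ x ≺ x) (≺-trans : Transitive _≺_)
         (_≺?_ : Decidable _≺_) where

  maximal : ∀ {k} (α : Fin (suc k) → A) → ∃ λ i → ∀ j → ¬ α i ≺ α j
  maximal {zero}  α = zero , λ { zero → ≺-irrefl }
  maximal {suc k} α with maximal (α ∘ suc)
  ... | i , i-max with α (suc i) ≺? α zero
  ...   | no ¬i≺0 = suc i , λ { zero → ¬i≺0 ; (suc j) → i-max j }
  ...   | yes i≺0 = zero , λ { zero → ≺-irrefl ; (suc j) → i-max j ∘ ≺-trans i≺0 }

-- The coefficient of a maximal leading term is forced to vanish; then induct on the rest.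
module _ {m : ℕ} {_≺_ : Rel (CComp m) 0ℓ} (≺-irrefl : ∀ {x} → ¬ x ≺ x)
         (≺-trans : Transitive _≺_) (_≺?_ : Decidable _≺_) where

  triangular⇒linIndep : ∀ {k} (v : Fin k → QVec m) (lead : Fin k → CComp m) →
                        (∀ {i j} → lead i ≡ lead j → i ≡ j) →
                        (∀ i → v i (lead i) ≢ 0ℚ) →
                        (∀ j γ → v j γ ≡ 0ℚ ⊎ γ ≡ lead j ⊎ γ ≺ lead j) →
                        LinIndep v
  triangular⇒linIndep {zero}  v lead _ _ _ c _ ()
  triangular⇒linIndep {suc k} v lead lead-inj lead≢0 support c c·v≡0 = c≡0
    where
    i = proj₁ (maximal ≺-irrefl ≺-trans _≺?_ lead)
    i-max = proj₂ (maximal ≺-irrefl ≺-trans _≺?_ lead)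

    rest : Fin k → QVec m
    rest = v ∘ punchIn i

    rest-combo : QVec m
    rest-combo = combo (c ∘ punchIn i) rest

    rest-vanishes-at-lead : ∀ j → c (punchIn i j) ≡ 0ℚ ⊎ rest j (lead i) ≡ 0ℚ
    rest-vanishes-at-lead j with support (punchIn i j) (lead i)
    ... | inj₁ v≡0         = inj₂ v≡0
    ... | inj₂ (inj₁ eq)   = ⊥-elim (punchInᵢ≢i i j (sym (lead-inj eq)))
    ... | inj₂ (inj₂ i≺j)  = ⊥-elim (i-max (punchIn i j) i≺j)

    cᵢ≡0 : c i ≡ 0ℚ
    cᵢ≡0 = p*q≡0⇒p≡0 (c i) (v i (lead i)) (lead≢0 i) (begin
      c i ℚ.* v i (lead i)
        ≡⟨ sym (ℚP.+-identityʳ _) ⟩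
      c i ℚ.* v i (lead i) ℚ.+ 0ℚ
        ≡⟨ cong (c i ℚ.* v i (lead i) ℚ.+_)
                (sym (combo≡0 (c ∘ punchIn i) rest (lead i) rest-vanishes-at-lead)) ⟩
      c i ℚ.* v i (lead i) ℚ.+ rest-combo (lead i)
        ≡⟨ sym (combo-remove c v i (lead i)) ⟩
      combo c v (lead i)
        ≡⟨ c·v≡0 (lead i) ⟩
      0ℚ ∎)
      where open ≡-Reasoning

    rest-combo≡0 : ∀ β → rest-combo β ≡ 0ℚ
    rest-combo≡0 β = begin
      rest-combo β
        ≡⟨ sym (ℚP.+-identityˡ _) ⟩
      0ℚ ℚ.+ rest-combo β
        ≡⟨ cong (ℚ._+ rest-combo β) (sym (trans (cong (ℚ._* v i β) cᵢ≡0) (ℚP.*-zeroˡ (v i β)))) ⟩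
      c i ℚ.* v i β ℚ.+ rest-combo β
        ≡⟨ sym (combo-remove c v i β) ⟩
      combo c v β
        ≡⟨ c·v≡0 β ⟩
      0ℚ ∎
      where open ≡-Reasoning

    c∘punchIn≡0 : ∀ j → c (punchIn i j) ≡ 0ℚ
    c∘punchIn≡0 = triangular⇒linIndep rest (lead ∘ punchIn i)
                    (punchIn-injective i _ _ ∘ lead-inj) (lead≢0 ∘ punchIn i)
                    (support ∘ punchIn i) (c ∘ punchIn i) rest-combo≡0

    c≡0 : ∀ j → c j ≡ 0ℚ
    c≡0 j with j Fin.≟ i
    ... | yes refl = cᵢ≡0
    ... | no j≢i   = subst (λ x → c x ≡ 0ℚ) (punchIn-punchOut (j≢i ∘ sym))
                       (c∘punchIn≡0 (punchOut (j≢i ∘ sym)))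

unitVector : ∀ {k} → Fin k → Fin k → ℚ
unitVector j i = if does (i Fin.≟ j) then 1ℚ else 0ℚ

combo-unitVector : ∀ {m k} (v : Fin k → QVec m) j β → combo (unitVector j) v β ≡ v j β
combo-unitVector {k = suc k} v j β = begin
  combo (unitVector j) v β
    ≡⟨ combo-remove (unitVector j) v j β ⟩
  unitVector j j ℚ.* v j β ℚ.+ combo (unitVector j ∘ punchIn j) (v ∘ punchIn j) β
    ≡⟨ cong₂ ℚ._+_ (cong (λ d → (if d then 1ℚ else 0ℚ) ℚ.* v j β) (dec-true (j Fin.≟ j) refl))
                   (combo≡0 (unitVector j ∘ punchIn j) (v ∘ punchIn j) β (λ i → inj₁ (off-diagonal i))) ⟩
  1ℚ ℚ.* v j β ℚ.+ 0ℚ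
    ≡⟨ ℚP.+-identityʳ _ ⟩
  1ℚ ℚ.* v j β
    ≡⟨ ℚP.*-identityˡ _ ⟩
  v j β ∎
  where
  open ≡-Reasoning
  off-diagonal : ∀ i → unitVector j (punchIn j i) ≡ 0ℚ
  off-diagonal i = cong (λ d → if d then 1ℚ else 0ℚ) (dec-false (punchIn j i Fin.≟ j) (punchInᵢ≢i j i))

linIndep⇒spanDim : ∀ {m k} (v : Fin k → QVec m) → LinIndep v → SpanDim v k
linIndep⇒spanDim v v-indep = v , v-indep , inSpan-self , inSpan-self
  where
  inSpan-self : ∀ j → InSpan v (v j)
  inSpan-self j = unitVector j , combo-unitVector v j

∈-concatMap⁺′ : ∀ {A B : Set} (f : A → List B) {x y xs} → x ∈ xs → y ∈ f x → y ∈ concatMap f xs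
∈-concatMap⁺′ f x∈xs y∈fx = ∈-concatMap⁺ f (lose x∈xs y∈fx)

∈-concatMap⁻′ : ∀ {A B : Set} (f : A → List B) {y} xs → y ∈ concatMap f xs → ∃ λ x → x ∈ xs × y ∈ f x
∈-concatMap⁻′ f xs = find ∘ ∈-concatMap⁻ f {xs}

∈-if : ∀ {A : Set} b {x y : A} → y ∈ (if b then [ x ] else []) → T b × y ≡ x
∈-if true (here y≡x) = _ , y≡x

∈-if⁺ : ∀ {A : Set} {b} {x : A} → T b → x ∈ (if b then [ x ] else [])
∈-if⁺ {b = true} _ = here refl

Unique-concatMap⁺ : ∀ {A B : Set} {f : A → List B} →
                    (∀ {x x′ y} → y ∈ f x → y ∈ f x′ → x ≡ x′) → (∀ x → Unique (f x)) →
                    ∀ {xs} → Unique xs → Unique (concatMap f xs)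
Unique-concatMap⁺ {f = f} separated f-unique {xs} xs-unique =
  Unique.concat⁺ (All.map⁺ (All.universal f-unique xs)) (AllPairs.map⁺ (AllPairs.map disjoint xs-unique))
  where
  disjoint : ∀ {x x′} → x ≢ x′ → Disjoint (f x) (f x′)
  disjoint x≢x′ (y∈fx , y∈fx′) = x≢x′ (separated y∈fx y∈fx′)

lookup-injective : ∀ {A : Set} {xs : List A} → Unique xs → ∀ i j → lookup xs i ≡ lookup xs j → i ≡ j
lookup-injective (_ ∷ _)          zero    zero    _  = refl
lookup-injective (x∉xs ∷ _)       zero    (suc j) eq = ⊥-elim (All.lookup x∉xs (∈-lookup j) eq)
lookup-injective (x∉xs ∷ _)       (suc i) zero    eq = ⊥-elim (All.lookup x∉xs (∈-lookup i) (sym eq))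
lookup-injective (_ ∷ xs-unique)  (suc i) (suc j) eq = cong suc (lookup-injective xs-unique i j eq)

countᵇ : ∀ {A : Set} → (A → Bool) → List A → ℕ
countᵇ p xs = length (filterᵇ p xs)

countᵇ-++ : ∀ {A : Set} (p : A → Bool) xs ys → countᵇ p (xs ++ ys) ≡ countᵇ p xs + countᵇ p ys
countᵇ-++ p xs ys = trans (cong length (filter-++ (T? ∘ p) xs ys)) (length-++ (filterᵇ p xs))

countᵇ-concatMap : ∀ {A B : Set} (p : B → Bool) (f : A → List B) xs →
                   countᵇ p (concatMap f xs) ≡ sum (map (countᵇ p ∘ f) xs)
countᵇ-concatMap p f []       = refl
countᵇ-concatMap p f (x ∷ xs) =
  trans (countᵇ-++ p (f x) (concatMap f xs)) (cong (countᵇ p (f x) +_) (countᵇ-concatMap p f xs))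

countᵇ-map : ∀ {A B : Set} {p : B → Bool} {q : A → Bool} (g : A → B) →
             (∀ x → p (g x) ≡ q x) → ∀ xs → countᵇ p (map g xs) ≡ countᵇ q xs
countᵇ-map g pg≡q []                            = refl
countᵇ-map {q = q} g pg≡q (x ∷ xs) rewrite pg≡q x with q x
... | true  = cong suc (countᵇ-map g pg≡q xs)
... | false = countᵇ-map g pg≡q xs

countᵇ-∧ : ∀ {A : Set} b (q : A → Bool) xs → countᵇ (λ x → b ∧ q x) xs ≡ (if b then countᵇ q xs else 0)
countᵇ-∧ true  q xs       = refl
countᵇ-∧ false q []       = refl
countᵇ-∧ false q (_ ∷ xs) = countᵇ-∧ false q xs

sum-map-* : ∀ {A : Set} {f g : A → ℕ} k {xs} → All (λ x → f x ≡ k * g x) xs →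
            sum (map f xs) ≡ k * sum (map g xs)
sum-map-* k []       = sym (ℕP.*-zeroʳ k)
sum-map-* k (e ∷ es) = trans (cong₂ _+_ e (sum-map-* k es)) (sym (ℕP.*-distribˡ-+ k _ _))

sum-map-allFin : ∀ {n} (g : Fin n → ℕ) → sum (map g (allFin n)) ≡ ℕΣ.sum g
sum-map-allFin g = trans (cong sum (map-tabulate id g)) (sum-tabulate g)
  where
  sum-tabulate : ∀ {n} (h : Fin n → ℕ) → sum (tabulate h) ≡ ℕΣ.sum h
  sum-tabulate {zero}  h = refl
  sum-tabulate {suc n} h = cong (h zero +_) (sum-tabulate (h ∘ suc))

∑-const : ∀ n H → ℕΣ.sum {n} (λ _ → H) ≡ n * H
∑-const zero    H = refl
∑-const (suc n) H = cong (H +_) (∑-const n H)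

infix 4 _<ₗ_ _≤ₗ_

data _<ₗ_ : List ℕ → List ℕ → Set where
  here  : ∀ {a b as bs} → a < b → a ∷ as <ₗ b ∷ bs
  there : ∀ {a as bs} → as <ₗ bs → a ∷ as <ₗ a ∷ bs

_≤ₗ_ : List ℕ → List ℕ → Set
β ≤ₗ α = β ≡ α ⊎ β <ₗ α

∷-≤ₗ : ∀ a {β α} → β ≤ₗ α → a ∷ β ≤ₗ a ∷ α
∷-≤ₗ a (inj₁ refl) = inj₁ refl
∷-≤ₗ a (inj₂ lt)   = inj₂ (there lt)

suc-≤ₗ : ∀ {b a β α} → b ∷ β ≤ₗ a ∷ α → suc b ∷ β ≤ₗ suc a ∷ α
suc-≤ₗ (inj₁ refl)         = inj₁ refl
suc-≤ₗ (inj₂ (here b<a))   = inj₂ (here (ℕ.s≤s b<a))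
suc-≤ₗ (inj₂ (there lt))   = inj₂ (there lt)

-- Colored compositions are compared through their parts; the colours only matter for equality.
module _ {m : ℕ} where

  infix 4 _◁_ _⊴_

  data _◁_ : CComp m → CComp m → Set where
    here  : ∀ {a b j j′ γ α} → a < b → (a , j) ∷ γ ◁ (b , j′) ∷ α
    there : ∀ {x γ α} → γ ◁ α → x ∷ γ ◁ x ∷ α

  _⊴_ : CComp m → CComp m → Set
  γ ⊴ α = γ ≡ α ⊎ γ ◁ α

  ◁-irrefl : ∀ {α} → ¬ α ◁ α
  ◁-irrefl (here a<a)  = ℕP.<-irrefl refl a<a
  ◁-irrefl (there lt) = ◁-irrefl lt

  ◁-trans : Transitive _◁_
  ◁-trans (here p)  (here q)  = here (ℕP.<-trans p q)
  ◁-trans (here p)  (there _) = here p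
  ◁-trans (there _) (here q)  = here q
  ◁-trans (there p) (there q) = there (◁-trans p q)

  _≟ᶜ_ : DecidableEquality (ℕ × Fin m)
  _≟ᶜ_ = ×P.≡-dec ℕ._≟_ Fin._≟_

  _◁?_ : Decidable _◁_
  []      ◁? _       = no λ ()
  (_ ∷ _) ◁? []      = no λ ()
  ((a , j) ∷ γ) ◁? ((b , j′) ∷ α) with a ℕ.<? b | (a , j) ≟ᶜ (b , j′)
  ... | yes a<b | _        = yes (here a<b)
  ... | no a≮b  | no ≢head = no λ { (here a<b) → a≮b a<b ; (there _) → ≢head refl }
  ... | no a≮b  | yes refl with γ ◁? α
  ...   | yes lt = yes (there lt)
  ...   | no ¬lt = no λ { (here a<a) → a≮b a<a ; (there lt) → ¬lt lt }

  ◁-++ : ∀ {γ α} γ′ α′ → γ ◁ α → γ ++ γ′ ◁ α ++ α′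
  ◁-++ γ′ α′ (here p)   = here p
  ◁-++ γ′ α′ (there lt) = there (◁-++ γ′ α′ lt)

  ++-◁ : ∀ δ {γ α} → γ ◁ α → δ ++ γ ◁ δ ++ α
  ++-◁ []      lt = lt
  ++-◁ (x ∷ δ) lt = there (++-◁ δ lt)

  ⊴-++ : ∀ {γ α γ′ α′} → γ ⊴ α → γ′ ⊴ α′ → γ ++ γ′ ⊴ α ++ α′
  ⊴-++         (inj₁ refl) (inj₁ refl) = inj₁ refl
  ⊴-++ {γ}     (inj₁ refl) (inj₂ lt)   = inj₂ (++-◁ γ lt)
  ⊴-++ {γ′ = γ′} {α′} (inj₂ lt) _     = inj₂ (◁-++ γ′ α′ lt)

  paint : Fin m → List ℕ → CComp m
  paint ε = map (_, ε)

  paint-◁ : ∀ ε {β α} → β <ₗ α → paint ε β ◁ paint ε α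
  paint-◁ ε (here b<a)  = here b<a
  paint-◁ ε (there lt) = there (paint-◁ ε lt)

  paint-⊴ : ∀ ε {β α} → β ≤ₗ α → paint ε β ⊴ paint ε α
  paint-⊴ ε (inj₁ refl) = inj₁ refl
  paint-⊴ ε (inj₂ lt)   = inj₂ (paint-◁ ε lt)

≡ᵇ-refl : ∀ n → T (n ≡ᵇ n)
≡ᵇ-refl n = ℕP.≡⇒≡ᵇ n n refl

isPeak-tail : ∀ a α → T (isPeak (a ∷ α)) → T (isPeak α)
isPeak-tail a []      _ = _
isPeak-tail a (b ∷ α) p with 2 ≤ᵇ a
... | true = p

-- In β*, every non-initial part b ≥ 2 is split as (1, b - 1); a peak composition has no part 1
-- before its last, so it must absorb that 1 into the preceding part, which then strictly
-- exceeds the corresponding part of β unless all parts agree.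
mutual
  starRest-≤ₗ : ∀ α β → T (isPeak α) → T (leq α (starRest β)) → β ≤ₗ α
  starRest-≤ₗ []                  []                  _ _ = inj₁ refl
  starRest-≤ₗ []                  (zero ∷ β)          _ ()
  starRest-≤ₗ []                  (suc zero ∷ β)      _ ()
  starRest-≤ₗ []                  (suc (suc b) ∷ β)   _ ()
  starRest-≤ₗ (a ∷ α)             []                  _ ()
  starRest-≤ₗ (a ∷ α)             (zero ∷ β)          p l = cons-≤ₗ a α zero β (isPeak-tail a α p) l
  starRest-≤ₗ (a ∷ α)             (suc zero ∷ β)      p l = cons-≤ₗ a α (suc zero) β (isPeak-tail a α p) l
  starRest-≤ₗ (zero ∷ α)          (suc (suc b) ∷ β)   _ ()
  starRest-≤ₗ (suc zero ∷ [])     (suc (suc b) ∷ β)   _ ()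
  starRest-≤ₗ (suc zero ∷ _ ∷ _)  (suc (suc b) ∷ β)   () _
  starRest-≤ₗ (suc (suc a) ∷ α)   (suc (suc b) ∷ β)   p l =
    suc-≤ₗ (cons-≤ₗ (suc a) α (suc b) β (isPeak-tail _ α p) l)

  cons-≤ₗ : ∀ a α b β → T (isPeak α) → T (leq (a ∷ α) (b ∷ starRest β)) → b ∷ β ≤ₗ a ∷ α
  cons-≤ₗ a α b β p l with a ≡ᵇ b | ℕP.≡ᵇ⇒≡ a b
  ... | true  | a≡b rewrite a≡b _ = ∷-≤ₗ b (starRest-≤ₗ α β p l)
  ... | false | _ with b <ᵇ a | ℕP.<ᵇ⇒< b a
  ...   | true  | b<a = inj₂ (here (b<a _))
  ...   | false | _   = ⊥-elim l

star-≤ₗ : ∀ α β → T (isPeak α) → T (leq α (star β)) → β ≤ₗ α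
star-≤ₗ []      []      _ _ = inj₁ refl
star-≤ₗ []      (_ ∷ _) _ ()
star-≤ₗ (_ ∷ _) []      _ ()
star-≤ₗ (a ∷ α) (b ∷ β) p l = cons-≤ₗ a α b β (isPeak-tail a α p) l

leq-starRest-self : ∀ α → T (leq α (starRest α))
leq-starRest-self []                = _
leq-starRest-self (zero ∷ α)        = leq-starRest-self α
leq-starRest-self (suc zero ∷ α)    = leq-starRest-self α
leq-starRest-self (suc (suc b) ∷ α) with b ≡ᵇ b | ≡ᵇ-refl b
... | true | _ = leq-starRest-self α

leq-star-self : ∀ α → T (leq α (star α))
leq-star-self []      = _
leq-star-self (a ∷ α) with a ≡ᵇ a | ≡ᵇ-refl a
... | true | _ = leq-starRest-self α

incHead : List ℕ → List ℕ
incHead []      = []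
incHead (a ∷ α) = suc a ∷ α

compsS-suc : ∀ n → compsS (suc n) ≡ map incHead (compsS n) ++ map (1 ∷_) (compsS n)
compsS-suc n = cong (_++ map (1 ∷_) (compsS n)) (map-cong (λ { [] → refl ; (_ ∷ _) → refl }) (compsS n))

data NonEmptyComposition : List ℕ → Set where
  nonEmpty : ∀ a {α} → All (0 <_) α → NonEmptyComposition (suc a ∷ α)

compsS-nonEmpty : ∀ n → All NonEmptyComposition (compsS n)
compsS-nonEmpty zero    = nonEmpty 0 [] ∷ []
compsS-nonEmpty (suc n) rewrite compsS-suc n =
  All.++⁺ (All.map⁺ (All.map incHead-nonEmpty (compsS-nonEmpty n)))
          (All.map⁺ (All.map 1∷-nonEmpty (compsS-nonEmpty n)))
  where
  incHead-nonEmpty : ∀ {α} → NonEmptyComposition α → NonEmptyComposition (incHead α)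
  incHead-nonEmpty (nonEmpty a α⁺) = nonEmpty (suc a) α⁺
  1∷-nonEmpty : ∀ {α} → NonEmptyComposition α → NonEmptyComposition (1 ∷ α)
  1∷-nonEmpty (nonEmpty a α⁺) = nonEmpty 0 (ℕ.s≤s ℕ.z≤n ∷ α⁺)

comps-positive : ∀ n → All (All (0 <_)) (comps n)
comps-positive zero    = [] ∷ []
comps-positive (suc n) = All.map (λ { (nonEmpty a α⁺) → ℕ.s≤s ℕ.z≤n ∷ α⁺ }) (compsS-nonEmpty n)

∈-compsS : ∀ a α → All (0 <_) α → suc a ∷ α ∈ compsS (a + sum α)
∈-compsS zero    []          []       = here refl
∈-compsS zero    (suc b ∷ α) (_ ∷ α⁺) rewrite compsS-suc (b + sum α) =
  ∈-++⁺ʳ (map incHead _) (∈-map⁺ (1 ∷_) (∈-compsS b α α⁺))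
∈-compsS (suc a) α           α⁺       rewrite compsS-suc (a + sum α) =
  ∈-++⁺ˡ (∈-map⁺ incHead (∈-compsS a α α⁺))

∈-comps : ∀ α → All (0 <_) α → α ∈ comps (sum α)
∈-comps []          []       = here refl
∈-comps (suc a ∷ α) (_ ∷ α⁺) = ∈-compsS a α α⁺

module _ {m : ℕ} where

  flatten : List (Fin m × List ℕ) → CComp m
  flatten = concatMap λ (ε , a) → paint ε a

  blocksTerms : List (Fin m × List ℕ) → Formal m
  blocksTerms = List.foldr (λ b acc → prodTerms (blockTerms (proj₁ b) (proj₂ b)) acc) ((1 , []) ∷ [])

  ∈-prodTerms⁺ : ∀ {X Y : Formal m} {w γ w′ γ′} → (w , γ) ∈ X → (w′ , γ′) ∈ Y →
                 (w * w′ , γ ++ γ′) ∈ prodTerms X Y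
  ∈-prodTerms⁺ x∈X y∈Y = ∈-concatMap⁺′ _ x∈X (∈-map⁺ _ y∈Y)

  ∈-prodTerms⁻ : ∀ (X Y : Formal m) {e} → e ∈ prodTerms X Y →
                 ∃₂ λ x y → x ∈ X × y ∈ Y × e ≡ (proj₁ x * proj₁ y , proj₂ x ++ proj₂ y)
  ∈-prodTerms⁻ X Y e∈ with ∈-concatMap⁻′ _ X e∈
  ... | x , x∈X , e∈xY with ∈-map⁻ _ e∈xY
  ...   | y , y∈Y , e≡ = x , y , x∈X , y∈Y , e≡

  blockTerms-support : ∀ (ε : Fin m) a {w γ} → T (isPeak a) → (w , γ) ∈ blockTerms ε a → γ ⊴ paint ε a
  blockTerms-support ε a a-peak t∈ with ∈-concatMap⁻′ _ (comps (sumℕ a)) t∈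
  ... | β , _ , t∈β with ∈-if (leq a (star β)) t∈β
  ...   | a≤β* , refl = paint-⊴ ε (star-≤ₗ a β a-peak a≤β*)

  blockTerms-leading : ∀ (ε : Fin m) a → All (0 <_) a → (2 ^ length a , paint ε a) ∈ blockTerms ε a
  blockTerms-leading ε a a⁺ = ∈-concatMap⁺′ _ (∈-comps a a⁺) (∈-if⁺ (leq-star-self a))

  blocksTerms-support : ∀ (bl : List (Fin m × List ℕ)) {w γ} → All (T ∘ isPeak ∘ proj₂) bl →
                        (w , γ) ∈ blocksTerms bl → γ ⊴ flatten bl
  blocksTerms-support []             []                  (here refl) = inj₁ refl
  blocksTerms-support ((ε , a) ∷ bl) (a-peak ∷ bl-peak) t∈
    with ∈-prodTerms⁻ (blockTerms ε a) (blocksTerms bl) t∈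
  ... | _ , _ , t₁∈ , t₂∈ , refl =
    ⊴-++ (blockTerms-support ε a a-peak t₁∈) (blocksTerms-support bl bl-peak t₂∈)

  blocksTerms-leading : ∀ (bl : List (Fin m × List ℕ)) → All (All (0 <_) ∘ proj₂) bl →
                        ∃ λ w → 0 < w × (w , flatten bl) ∈ blocksTerms bl
  blocksTerms-leading []             []         = 1 , ℕ.s≤s ℕ.z≤n , here refl
  blocksTerms-leading ((ε , a) ∷ bl) (a⁺ ∷ bl⁺) with blocksTerms-leading bl bl⁺
  ... | w , 0<w , t∈ =
    2 ^ length a * w , ℕP.*-mono-≤ (ℕP.m^n>0 2 (length a)) 0<w ,
    ∈-prodTerms⁺ (blockTerms-leading ε a a⁺) t∈

  ≟C-refl : ∀ (γ : CComp m) → (γ ≟C γ) ≡ true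
  ≟C-refl γ = dec-true (ListP.≡-dec _≟ᶜ_ γ γ) refl

  ≟C-sound : ∀ (δ γ : CComp m) → (δ ≟C γ) ≡ true → δ ≡ γ
  ≟C-sound δ γ δ≟γ = toWitness {a? = δ≟?γ} (subst T (sym (trans (isYes≗does δ≟?γ) δ≟γ)) _)
    where δ≟?γ = ListP.≡-dec _≟ᶜ_ δ γ

  ∈⇒≤coeffℕ : ∀ {X : Formal m} {w γ} → (w , γ) ∈ X → w ≤ coeffℕ X γ
  ∈⇒≤coeffℕ {(w , γ) ∷ X} (here refl) rewrite ≟C-refl γ = ℕP.m≤m+n w _
  ∈⇒≤coeffℕ {(w′ , δ) ∷ X} {γ = γ} (there t∈) =
    ℕP.≤-trans (∈⇒≤coeffℕ {X} t∈) (ℕP.m≤n+m _ (if δ ≟C γ then w′ else 0))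

  coeffℕ≡suc⇒∈ : ∀ (X : Formal m) γ {k} → coeffℕ X γ ≡ suc k → ∃ λ w → (w , γ) ∈ X
  coeffℕ≡suc⇒∈ ((w , δ) ∷ X) γ eq with δ ≟C γ in δ≟γ
  ... | true  = w , here (cong (w ,_) (sym (≟C-sound δ γ δ≟γ)))
  ... | false = map₂ there (coeffℕ≡suc⇒∈ X γ eq)

  flatten-rainbow : ∀ (α : CComp m) → flatten (rainbow α) ≡ α
  flatten-rainbow []            = refl
  flatten-rainbow ((a , j) ∷ α) with rainbow α | flatten-rainbow α
  ... | []              | eq = cong ((a , j) ∷_) eq
  ... | (j′ , bs) ∷ bl  | eq with j Fin.≟ j′
  ...   | yes refl = cong ((a , j) ∷_) eq
  ...   | no _     = cong ((a , j) ∷_) eq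

  rainbow-positive : ∀ (α : CComp m) → All ((0 <_) ∘ proj₁) α → All (All (0 <_) ∘ proj₂) (rainbow α)
  rainbow-positive []            []       = []
  rainbow-positive ((a , j) ∷ α) (a⁺ ∷ α⁺) with rainbow α | rainbow-positive α α⁺
  ... | []             | _           = (a⁺ ∷ []) ∷ []
  ... | (j′ , bs) ∷ bl | bs⁺ ∷ bl⁺ with j Fin.≟ j′
  ...   | yes refl = (a⁺ ∷ bs⁺) ∷ bl⁺
  ...   | no _     = (a⁺ ∷ []) ∷ bs⁺ ∷ bl⁺

  K-support : ∀ (α γ : CComp m) → T (isCPeak α) → K α γ ≡ 0ℚ ⊎ γ ⊴ α
  K-support α γ α-peak with coeffℕ (Kterms α) γ in eq
  ... | zero  = inj₁ refl
  ... | suc _ with coeffℕ≡suc⇒∈ (Kterms α) γ eq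
  ...   | _ , t∈ = inj₂ (subst (γ ⊴_) (flatten-rainbow α)
                     (blocksTerms-support (rainbow α) (All.all⁺ _ (rainbow α) α-peak) t∈))

  K-leading : ∀ (α : CComp m) → All ((0 <_) ∘ proj₁) α → K α α ≢ 0ℚ
  K-leading α α⁺ with blocksTerms-leading (rainbow α) (rainbow-positive α α⁺)
  ... | w , 0<w , t∈ = +n/1≢0 (ℕP.<-≤-trans 0<w
                         (∈⇒≤coeffℕ (subst (λ γ → (w , γ) ∈ Kterms α) (flatten-rainbow α) t∈)))

compsS-unique : ∀ n → Unique (compsS n)
compsS-unique zero    = [] ∷ []
compsS-unique (suc n) rewrite compsS-suc n =
  Unique.++⁺ (Unique.map⁺ incHead-injective (compsS-unique n))
             (Unique.map⁺ ∷-injectiveʳ (compsS-unique n)) disjoint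
  where
  incHead-injective : ∀ {α β} → incHead α ≡ incHead β → α ≡ β
  incHead-injective {[]}    {[]}    _    = refl
  incHead-injective {[]}    {_ ∷ _} ()
  incHead-injective {_ ∷ _} {[]}    ()
  incHead-injective {_ ∷ _} {_ ∷ _} refl = refl

  disjoint : Disjoint (map incHead (compsS n)) (map (1 ∷_) (compsS n))
  disjoint (γ∈ , γ∈′) with ∈-map⁻ incHead γ∈ | ∈-map⁻ (1 ∷_) γ∈′
  ... | α , α∈ , refl | _ , _ , eq with All.lookup (compsS-nonEmpty n) α∈
  ...   | nonEmpty _ _ with () ← eq

comps-unique : ∀ n → Unique (comps n)
comps-unique zero    = [] ∷ []
comps-unique (suc n) = compsS-unique n

module _ {m : ℕ} where

  parts : CComp m → List ℕ
  parts = map proj₁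

  colorings-parts : ∀ c {γ} → γ ∈ colorings m c → parts γ ≡ c
  colorings-parts []      (here refl) = refl
  colorings-parts (a ∷ c) γ∈ with ∈-concatMap⁻′ _ (allFin m) γ∈
  ... | _ , _ , γ∈j with ∈-map⁻ _ γ∈j
  ...   | γ′ , γ′∈ , refl = cong (a ∷_) (colorings-parts c γ′∈)

  colorings-unique : ∀ c → Unique (colorings m c)
  colorings-unique []      = [] ∷ []
  colorings-unique (a ∷ c) =
    Unique-concatMap⁺ same-colour (λ _ → Unique.map⁺ ∷-injectiveʳ (colorings-unique c)) (Unique.allFin⁺ m)
    where
    same-colour : ∀ {j j′ γ} → γ ∈ map ((a , j) ∷_) (colorings m c) →
                  γ ∈ map ((a , j′) ∷_) (colorings m c) → j ≡ j′
    same-colour γ∈ γ∈′ with ∈-map⁻ _ γ∈ | ∈-map⁻ _ γ∈′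
    ... | _ , _ , refl | _ , _ , refl = refl

  peakComps-unique : ∀ n → Unique (peakComps m n)
  peakComps-unique n =
    Unique.filter⁺ (T? ∘ isCPeak) (Unique-concatMap⁺ same-parts colorings-unique (comps-unique n))
    where
    same-parts : ∀ {c c′ γ} → γ ∈ colorings m c → γ ∈ colorings m c′ → c ≡ c′
    same-parts γ∈ γ∈′ = trans (sym (colorings-parts _ γ∈)) (colorings-parts _ γ∈′)

  ∈-peakComps : ∀ {n α} → α ∈ peakComps m n → T (isCPeak α) × All ((0 <_) ∘ proj₁) α
  ∈-peakComps {n} α∈ with ∈-filter⁻ (T? ∘ isCPeak) {xs = ccomps m n} α∈
  ... | α∈cc , α-peak with ∈-concatMap⁻′ (colorings m) (comps n) α∈cc
  ...   | c , c∈ , α∈c =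
    α-peak , All.map⁻ (subst (All (0 <_)) (sym (colorings-parts c α∈c)) (All.lookup (comps-positive n) c∈))

module _ {m : ℕ} where

  rainbow-∷ : ∀ a (j : Fin m) α → ∃₂ λ as bl → rainbow ((a , j) ∷ α) ≡ (j , a ∷ as) ∷ bl
  rainbow-∷ a j α with rainbow α
  ... | []             = [] , [] , refl
  ... | (j′ , bs) ∷ bl with j Fin.≟ j′
  ...   | yes refl = bs , bl , refl
  ...   | no _     = [] , (j′ , bs) ∷ bl , refl

  canFollow : ℕ → Fin m → Fin m → Bool
  canFollow a j j′ = if does (j Fin.≟ j′) then 2 ≤ᵇ a else true

  isCPeak-∷-∷ : ∀ a (j : Fin m) b j′ γ →
                isCPeak ((a , j) ∷ (b , j′) ∷ γ) ≡ canFollow a j j′ ∧ isCPeak ((b , j′) ∷ γ)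
  isCPeak-∷-∷ a j b j′ γ with rainbow-∷ b j′ γ
  ... | bs , bl , eq rewrite eq with j Fin.≟ j′
  ...   | yes refl = ∧-assoc (2 ≤ᵇ a) (isPeak (b ∷ bs)) _
  ...   | no _     = refl

module _ (p : ℕ) where

  choices : ℕ → ℕ
  choices b = if 2 ≤ᵇ b then suc p else p

  headFixed : List ℕ → ℕ
  headFixed []           = 1
  headFixed (_ ∷ [])     = 1
  headFixed (b ∷ b′ ∷ β) = choices b * headFixed (b′ ∷ β)

  -- Only the colour of the previous part can be excluded, and only when that part is 1.
  colour-choices : ∀ b (j : Fin (suc p)) H →
                   sum (map (λ j′ → if canFollow b j j′ then H else 0) (allFin (suc p))) ≡ choices b * H
  colour-choices b j H = begin
    sum (map g (allFin (suc p)))        ≡⟨ sum-map-allFin g ⟩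
    ℕΣ.sum g                            ≡⟨ ℕΣ.sum-remove {i = j} g ⟩
    g j + ℕΣ.sum (g ∘ punchIn j)        ≡⟨ cong₂ _+_ g-at-j (trans (ℕΣ.sum-cong-≗ g-off-j) (∑-const p H)) ⟩
    (if 2 ≤ᵇ b then H else 0) + p * H   ≡⟨ split (2 ≤ᵇ b) ⟩
    choices b * H                       ∎
    where
    open ≡-Reasoning
    g : Fin (suc p) → ℕ
    g j′ = if canFollow b j j′ then H else 0
    g-at-j : g j ≡ (if 2 ≤ᵇ b then H else 0)
    g-at-j = cong (λ d → if (if d then 2 ≤ᵇ b else true) then H else 0) (dec-true (j Fin.≟ j) refl)
    g-off-j : ∀ i → g (punchIn j i) ≡ H
    g-off-j i = cong (λ d → if (if d then 2 ≤ᵇ b else true) then H else 0)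
                     (dec-false (j Fin.≟ punchIn j i) (punchInᵢ≢i j i ∘ sym))
    split : ∀ t → (if t then H else 0) + p * H ≡ (if t then suc p else p) * H
    split true  = refl
    split false = refl

  count-fixedHead : ∀ b j β → countᵇ (isCPeak ∘ ((b , j) ∷_)) (colorings (suc p) β) ≡ headFixed (b ∷ β)
  count-fixedHead b j []       = refl
  count-fixedHead b j (b′ ∷ β) = begin
    countᵇ P (concatMap F (allFin (suc p)))
      ≡⟨ countᵇ-concatMap P F (allFin (suc p)) ⟩
    sum (map (countᵇ P ∘ F) (allFin (suc p)))
      ≡⟨ cong sum (map-cong count-F (allFin (suc p))) ⟩
    sum (map (λ j′ → if canFollow b j j′ then H else 0) (allFin (suc p)))
      ≡⟨ colour-choices b j H ⟩
    choices b * H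
      ∎
    where
    open ≡-Reasoning
    P : CComp (suc p) → Bool
    P = isCPeak ∘ ((b , j) ∷_)
    Z = colorings (suc p) β
    F : Fin (suc p) → List (CComp (suc p))
    F j′ = map ((b′ , j′) ∷_) Z
    H = headFixed (b′ ∷ β)
    count-F : ∀ j′ → countᵇ P (F j′) ≡ (if canFollow b j j′ then H else 0)
    count-F j′ = begin
      countᵇ P (F j′)
        ≡⟨ countᵇ-map _ (isCPeak-∷-∷ b j b′ j′) Z ⟩
      countᵇ (λ γ → canFollow b j j′ ∧ isCPeak ((b′ , j′) ∷ γ)) Z
        ≡⟨ countᵇ-∧ (canFollow b j j′) _ Z ⟩
      (if canFollow b j j′ then countᵇ (isCPeak ∘ ((b′ , j′) ∷_)) Z else 0)
        ≡⟨ cong (λ k → if canFollow b j j′ then k else 0) (count-fixedHead b′ j′ β) ⟩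
      (if canFollow b j j′ then H else 0)
        ∎

  count-colorings : ∀ b β → countᵇ isCPeak (colorings (suc p) (b ∷ β)) ≡ suc p * headFixed (b ∷ β)
  count-colorings b β = begin
    countᵇ isCPeak (colorings (suc p) (b ∷ β))
      ≡⟨ countᵇ-concatMap isCPeak (λ j → map ((b , j) ∷_) Z) (allFin (suc p)) ⟩
    sum (map (λ j → countᵇ isCPeak (map ((b , j) ∷_) Z)) (allFin (suc p)))
      ≡⟨ cong sum (map-cong (λ j → trans (countᵇ-map _ (λ _ → refl) Z) (count-fixedHead b j β))
                            (allFin (suc p))) ⟩
    sum (map (λ _ → headFixed (b ∷ β)) (allFin (suc p)))
      ≡⟨ trans (sum-map-allFin {suc p} (λ _ → headFixed (b ∷ β))) (∑-const (suc p) (headFixed (b ∷ β))) ⟩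
    suc p * headFixed (b ∷ β)
      ∎
    where
    open ≡-Reasoning
    Z = colorings (suc p) β

  σ τ : ℕ → ℕ
  σ n = sum (map headFixed (compsS n))
  τ n = sum (map (headFixed ∘ incHead) (compsS n))

  length-peakComps≡*σ : ∀ n → length (peakComps (suc p) (suc n)) ≡ suc p * σ n
  length-peakComps≡*σ n =
    trans (countᵇ-concatMap isCPeak (colorings (suc p)) (compsS n))
          (sum-map-* (suc p) (All.map (λ { (nonEmpty a {α} _) → count-colorings (suc a) α })
                                      (compsS-nonEmpty n)))

  sum-compsS-suc : ∀ (h : List ℕ → ℕ) n →
                   sum (map h (compsS (suc n))) ≡
                   sum (map (h ∘ incHead) (compsS n)) + sum (map (h ∘ (1 ∷_)) (compsS n))
  sum-compsS-suc h n = begin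
    sum (map h (compsS (suc n)))
      ≡⟨ cong (sum ∘ map h) (compsS-suc n) ⟩
    sum (map h (map incHead L ++ map (1 ∷_) L))
      ≡⟨ cong sum (map-++ h (map incHead L) _) ⟩
    sum (map h (map incHead L) ++ map h (map (1 ∷_) L))
      ≡⟨ sum-++ (map h (map incHead L)) _ ⟩
    sum (map h (map incHead L)) + sum (map h (map (1 ∷_) L))
      ≡⟨ cong₂ _+_ (cong sum (sym (map-∘ L))) (cong sum (sym (map-∘ L))) ⟩
    sum (map (h ∘ incHead) L) + sum (map (h ∘ (1 ∷_)) L)
      ∎
    where
    open ≡-Reasoning
    L = compsS n

  σ-suc : ∀ n → σ (suc n) ≡ τ n + p * σ n
  σ-suc n = trans (sum-compsS-suc headFixed n)
                  (cong (τ n +_) (sum-map-* p (All.map (λ { (nonEmpty _ _) → refl }) (compsS-nonEmpty n))))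

  τ-suc : ∀ n → τ (suc n) ≡ τ n + suc p * σ n
  τ-suc n = trans (sum-compsS-suc (headFixed ∘ incHead) n)
                  (cong₂ _+_ (cong sum (map-cong-local (All.map incHead-twice (compsS-nonEmpty n))))
                             (sum-map-* (suc p) (All.map (λ { (nonEmpty _ _) → refl }) (compsS-nonEmpty n))))
    where
    incHead-twice : ∀ {α} → NonEmptyComposition α → headFixed (incHead (incHead α)) ≡ headFixed (incHead α)
    incHead-twice (nonEmpty _ {[]}    _) = refl
    incHead-twice (nonEmpty _ {_ ∷ _} _) = refl

  σ-rec : ∀ n → σ (suc (suc n)) ≡ suc p * σ (suc n) + σ n
  σ-rec n = begin
    σ (suc (suc n))                             ≡⟨ σ-suc (suc n) ⟩
    τ (suc n) + p * σ (suc n)                   ≡⟨ cong₂ (λ t s → t + p * s) (τ-suc n) (σ-suc n) ⟩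
    (τ n + suc p * σ n) + p * (τ n + p * σ n)   ≡⟨ rearrange p (τ n) (σ n) ⟩
    suc p * (τ n + p * σ n) + σ n               ≡⟨ cong (λ s → suc p * s + σ n) (sym (σ-suc n)) ⟩
    suc p * σ (suc n) + σ n                     ∎
    where
    open ≡-Reasoning
    rearrange : ∀ p t s → (t + suc p * s) + p * (t + p * s) ≡ suc p * (t + p * s) + s
    rearrange = solve-∀

  f≡*σ : ∀ n → f (suc p) (suc n) ≡ suc p * σ n
  f≡*σ zero          = sym (ℕP.*-identityʳ (suc p))
  f≡*σ (suc zero)    = cong (suc p *_) (sym (trans (σ-suc 0) (cong suc (ℕP.*-identityʳ p))))
  f≡*σ (suc (suc n)) = begin
    suc p * f (suc p) (suc (suc n)) + f (suc p) (suc n)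
      ≡⟨ cong₂ (λ a b → suc p * a + b) (f≡*σ (suc n)) (f≡*σ n) ⟩
    suc p * (suc p * σ (suc n)) + suc p * σ n
      ≡⟨ sym (ℕP.*-distribˡ-+ (suc p) (suc p * σ (suc n)) (σ n)) ⟩
    suc p * (suc p * σ (suc n) + σ n)
      ≡⟨ cong (suc p *_) (sym (σ-rec n)) ⟩
    suc p * σ (suc (suc n))
      ∎
    where open ≡-Reasoning

  length-peakComps : ∀ n → length (peakComps (suc p) (suc n)) ≡ f (suc p) (suc n)
  length-peakComps n = trans (length-peakComps≡*σ n) (sym (f≡*σ n))

PiFamily-linIndep : ∀ m n → LinIndep (PiFamily m n)
PiFamily-linIndep m n =
  triangular⇒linIndep ◁-irrefl ◁-trans _◁?_ (PiFamily m n) (lookup αs)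
    (lookup-injective (peakComps-unique n) _ _)
    (λ i → K-leading (lookup αs i) (proj₂ (lookup-peak i)))
    (λ i γ → K-support (lookup αs i) γ (proj₁ (lookup-peak i)))
  where
  αs = peakComps m n
  lookup-peak : ∀ i → T (isCPeak (lookup αs i)) × All ((0 <_) ∘ proj₁) (lookup αs i)
  lookup-peak i = ∈-peakComps {n = n} (∈-lookup {xs = αs} i)

mainTheorem13 : (m n : ℕ) → 1 ≤ m → 1 ≤ n → SpanDim (PiFamily m n) (f m n)
mainTheorem13 (suc p) (suc n) _ _ =
  subst (SpanDim (PiFamily (suc p) (suc n))) (length-peakComps p n)
        (linIndep⇒spanDim (PiFamily (suc p) (suc n)) (PiFamily-linIndep (suc p) (suc n)))
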